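{- For any Heyting algebra $H$ and any $x,h,a\in H$, $$x\to((h\to a)\to h)=((x\to h)\to a)\to(x\to h).$$ -}

module Defs where

module Submission where

open import Defs
open import Level using (Level)
open import Relation.Binary.Lattice using (HeytingAlgebra)
import Relation.Binary.Lattice.Properties.HeytingAlgebra as HeytingAlgebraProperties
import Relation.Binary.Lattice.Properties.MeetSemilattice as MeetSemilatticeProperties
import Relation.Binary.Reasoning.Setoid as SetoidReasoning

-- Currying turns both sides into implications into h, with antecedents
-- x ∧ (h ⇨ a) and ((x ⇨ h) ⇨ a) ∧ x.  These agree: below x, the element
-- x ⇨ h is just h, and an implication y ⇨ a below x only depends on x ∧ y.

module RelativeImplication {c ℓ₁ ℓ₂ : Level} (H : HeytingAlgebra c ℓ₁ ℓ₂) where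

  open HeytingAlgebra H
  open HeytingAlgebraProperties H using (⇨-app; ⇨-applyˡ)
  open MeetSemilatticeProperties meetSemilattice using (∧-comm; ∧-monotonic)

  x∧z≤y⇒x∧[y⇨w]≤z⇨w : ∀ {x y z w} → x ∧ z ≤ y → x ∧ (y ⇨ w) ≤ z ⇨ w
  x∧z≤y⇒x∧[y⇨w]≤z⇨w x∧z≤y = transpose-⇨ (trans regroup (⇨-applyˡ x∧z≤y))
    where
    regroup : ∀ {x u z} → (x ∧ u) ∧ z ≤ u ∧ (x ∧ z)
    regroup = ∧-greatest (trans (x∧y≤x _ _) (x∧y≤y _ _)) (∧-monotonic (x∧y≤x _ _) refl)

  x∧y≈x∧z⇒x∧[y⇨w]≈x∧[z⇨w] : ∀ {x y z w} → x ∧ y ≈ x ∧ z → x ∧ (y ⇨ w) ≈ x ∧ (z ⇨ w)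
  x∧y≈x∧z⇒x∧[y⇨w]≈x∧[z⇨w] x∧y≈x∧z = antisym
    (∧-greatest (x∧y≤x _ _) (x∧z≤y⇒x∧[y⇨w]≤z⇨w (trans (reflexive (Eq.sym x∧y≈x∧z)) (x∧y≤y _ _))))
    (∧-greatest (x∧y≤x _ _) (x∧z≤y⇒x∧[y⇨w]≤z⇨w (trans (reflexive x∧y≈x∧z) (x∧y≤y _ _))))

  x∧[x⇨y]≈x∧y : ∀ {x y} → x ∧ (x ⇨ y) ≈ x ∧ y
  x∧[x⇨y]≈x∧y {x} {y} = begin
    x ∧ (x ⇨ y) ≈⟨ ∧-comm _ _ ⟩
    (x ⇨ y) ∧ x ≈⟨ ⇨-app ⟩
    y ∧ x       ≈⟨ ∧-comm _ _ ⟩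
    x ∧ y       ∎
    where open SetoidReasoning setoid

lemma2p4 : ∀ {c ℓ₁ ℓ₂ : Level} (H : HeytingAlgebra c ℓ₁ ℓ₂) →
    let open HeytingAlgebra H in
    ∀ (x h a : Carrier) → (x ⇨ ((h ⇨ a) ⇨ h)) ≈ (((x ⇨ h) ⇨ a) ⇨ (x ⇨ h))
lemma2p4 H x h a = begin
  x ⇨ ((h ⇨ a) ⇨ h)           ≈⟨ Eq.sym ⇨-curry ⟩
  (x ∧ (h ⇨ a)) ⇨ h           ≈⟨ ⇨-cong (x∧y≈x∧z⇒x∧[y⇨w]≈x∧[z⇨w] (Eq.sym x∧[x⇨y]≈x∧y)) Eq.refl ⟩
  (x ∧ ((x ⇨ h) ⇨ a)) ⇨ h     ≈⟨ ⇨-cong (∧-comm _ _) Eq.refl ⟩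
  (((x ⇨ h) ⇨ a) ∧ x) ⇨ h     ≈⟨ ⇨-curry ⟩
  ((x ⇨ h) ⇨ a) ⇨ (x ⇨ h)     ∎
  where
  open HeytingAlgebra H
  open HeytingAlgebraProperties H using (⇨-curry; ⇨-cong)
  open MeetSemilatticeProperties meetSemilattice using (∧-comm)
  open RelativeImplication H
  open SetoidReasoning setoid
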